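{- Let $a,b$ be relatively prime integers with $1<a<b$ and $S=\langle a,b\rangle$. Let $i\in[1,a-1]$ with $I_{i,a}(S)\neq\varnothing$, and let $h_i=\min I_{i,a}(S)$. If $n$ is the smallest positive integer such that $h_i+na\in b\mathbb{N}$, then $I_{i,a}(S)=\{h_i,\ h_i+a,\ \dots,\ h_i+(n-1)a\}$.
   Context: $\langle a,b\rangle=\{\lambda_1a+\lambda_2b:\lambda_1,\lambda_2\in\mathbb{N}\}$, $b\mathbb{N}=\{bk:k\in\mathbb{N}\}$. $I(S)$ is the set of isolated gaps of $S$ (elements $x\in\mathbb{N}\setminus S$ with $x-1,x+1\in S$). For $i\in\{1,\dots,a-1\}$, $I_{i,a}(S)=\{s\in I(S): s\equiv i\pmod a\}$. -}

module Defs where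

open import Data.Nat using (ℕ; suc; _+_; _*_; _≤_; _<_; _%_; NonZero)
open import Data.Nat.Divisibility using (_∣_)
open import Data.Product using (Σ; ∃₂; _×_)
open import Relation.Binary.PropositionalEquality using (_≡_)
open import Relation.Nullary using (¬_)

InS : ℕ → ℕ → ℕ → Set
InS a b x = ∃₂ λ l₁ l₂ → x ≡ l₁ * a + l₂ * b

-- x is an isolated gap of ⟨a,b⟩: x ∉ S, x-1 ∈ S, x+1 ∈ S.
-- (x = suc y, since x - 1 must be a natural number.)
IsolatedGap : ℕ → ℕ → ℕ → Set
IsolatedGap a b x = Σ ℕ λ y → (x ≡ suc y) × ¬ InS a b x × InS a b y × InS a b (suc x)

InIia : (a b i : ℕ) → .{{NonZero a}} → ℕ → Set
InIia a b i x = IsolatedGap a b x × (x % a ≡ i)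

{-# OPTIONS --safe #-}
module Submission where

-- Every isolated gap in the residue class of i lies above h, hence is h + k·a. Adding multiples
-- of a preserves membership in S, so h + k·a inherits both neighbours in S from h and is an
-- isolated gap exactly when it is not in S. For k ≥ n, h + k·a = (h + n·a) + (k − n)·a ∈ S.
-- For k < n, writing h + k·a = l₁a + l₂b gives either h ∈ S (when l₁ ≥ k) or b ∣ h + (k − l₁)·a
-- with 0 < k − l₁ < n, both excluded.

open import Defs
open import Data.Nat using (ℕ; _+_; _*_; _∸_; _≤_; _<_; _%_; _/_; NonZero; _≤?_; s≤s)
open import Data.Nat.Properties
  using (+-cancelʳ-≡; +-assoc; +-comm; *-distribʳ-+; m+[n∸m]≡n; m≤n⇒∃[o]m+o≡n; m≤n+m; 0<1+n;
         ≰⇒>; ≤-<-trans)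
open import Data.Nat.DivMod using (m≡m%n+[m/n]*n; [m+kn]%n≡m%n; /-monoˡ-≤)
open import Data.Nat.GCD using (gcd)
open import Data.Nat.Divisibility using (_∣_; divides)
open import Data.Nat.Tactic.RingSolver using (solve)
open import Data.List using (_∷_; [])
open import Data.Product using (Σ; ∃; _×_; _,_)
open import Data.Sum using (_⊎_; inj₁; inj₂)
open import Relation.Binary.PropositionalEquality
  using (_≡_; refl; sym; trans; cong; cong₂; subst; module ≡-Reasoning)
open import Relation.Nullary using (¬_; yes; no; contradiction)
open import Function.Bundles using (_⇔_; mk⇔)

open ≡-Reasoning

%≡%∧≤⇒≡+* : ∀ d .{{_ : NonZero d}} {m n} → n % d ≡ m % d → m ≤ n → ∃ λ k → n ≡ m + k * d
%≡%∧≤⇒≡+* d {m} {n} n%d≡m%d m≤n = k , (begin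
  n                                ≡⟨ m≡m%n+[m/n]*n n d ⟩
  n % d + n / d * d                ≡⟨ cong₂ _+_ n%d≡m%d (cong (_* d) (sym m/d+k≡n/d)) ⟩
  m % d + (m / d + k) * d          ≡⟨ cong (m % d +_) (*-distribʳ-+ d (m / d) k) ⟩
  m % d + (m / d * d + k * d)      ≡⟨ +-assoc (m % d) (m / d * d) (k * d) ⟨
  m % d + m / d * d + k * d        ≡⟨ cong (_+ k * d) (m≡m%n+[m/n]*n m d) ⟨
  m + k * d                        ∎)
  where
  k = n / d ∸ m / d
  m/d+k≡n/d : m / d + k ≡ n / d
  m/d+k≡n/d = m+[n∸m]≡n (/-monoˡ-≤ d m≤n)

∣⇒InS : ∀ {a b x} → b ∣ x → InS a b x
∣⇒InS (divides q refl) = 0 , q , refl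

InS-+* : ∀ {a b x} k → InS a b x → InS a b (x + k * a)
InS-+* {a} {b} k (l₁ , l₂ , refl) = l₁ + k , l₂ , solve (l₁ ∷ l₂ ∷ k ∷ a ∷ b ∷ [])

∣+*⇒InS-+* : ∀ {a b h n k} → b ∣ h + n * a → n ≤ k → InS a b (h + k * a)
∣+*⇒InS-+* {a} {b} {h} {n} {k} b∣h+na n≤k =
  subst (InS a b) h+na+[k∸n]a≡h+ka (InS-+* (k ∸ n) (∣⇒InS b∣h+na))
  where
  h+na+[k∸n]a≡h+ka : h + n * a + (k ∸ n) * a ≡ h + k * a
  h+na+[k∸n]a≡h+ka = begin
    h + n * a + (k ∸ n) * a    ≡⟨ +-assoc h (n * a) ((k ∸ n) * a) ⟩
    h + (n * a + (k ∸ n) * a)  ≡⟨ cong (h +_) (*-distribʳ-+ a n (k ∸ n)) ⟨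
    h + (n + (k ∸ n)) * a      ≡⟨ cong (λ t → h + t * a) (m+[n∸m]≡n n≤k) ⟩
    h + k * a                  ∎

InS-+*-inv : ∀ {a b h} k → InS a b (h + k * a) →
             InS a b h ⊎ ∃ λ m → 0 < m × m ≤ k × b ∣ h + m * a
InS-+*-inv {a} {b} {h} k (l₁ , l₂ , h+ka≡l₁a+l₂b) with k ≤? l₁
... | yes k≤l₁ with m≤n⇒∃[o]m+o≡n k≤l₁
...   | j , refl = inj₁ (j , l₂ , +-cancelʳ-≡ (k * a) h _ (begin
  h + k * a                  ≡⟨ h+ka≡l₁a+l₂b ⟩
  (k + j) * a + l₂ * b       ≡⟨ solve (k ∷ j ∷ a ∷ l₂ ∷ b ∷ []) ⟩
  j * a + l₂ * b + k * a     ∎))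
InS-+*-inv {a} {b} {h} k (l₁ , l₂ , h+ka≡l₁a+l₂b) | no k≰l₁ with m≤n⇒∃[o]m+o≡n (≰⇒> k≰l₁)
...   | j , refl =
  inj₂ (1 + j , 0<1+n , s≤s (m≤n+m j l₁) , divides l₂ (+-cancelʳ-≡ (l₁ * a) _ _ (begin
  h + (1 + j) * a + l₁ * a   ≡⟨ solve (h ∷ j ∷ l₁ ∷ a ∷ []) ⟩
  h + (1 + l₁ + j) * a       ≡⟨ h+ka≡l₁a+l₂b ⟩
  l₁ * a + l₂ * b            ≡⟨ +-comm (l₁ * a) (l₂ * b) ⟩
  l₂ * b + l₁ * a            ∎)))

IsolatedGap-+* : ∀ {a b x} k → IsolatedGap a b x → ¬ InS a b (x + k * a) →
                 IsolatedGap a b (x + k * a)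
IsolatedGap-+* {a} k (y , refl , _ , y∈S , x+1∈S) x+ka∉S =
  y + k * a , refl , x+ka∉S , InS-+* k y∈S , InS-+* k x+1∈S

lemma4p6 : (a b : ℕ) → .{{_ : NonZero a}} → gcd a b ≡ 1 → 1 < a → a < b →
    (i : ℕ) → 1 ≤ i → i < a →
    (h : ℕ) → InIia a b i h → (∀ x → InIia a b i x → h ≤ x) →
    (n : ℕ) → 0 < n → b ∣ h + n * a → (∀ m → 0 < m → m < n → ¬ (b ∣ h + m * a)) →
    ∀ x → InIia a b i x ⇔ Σ ℕ (λ k → (k < n) × (x ≡ h + k * a))
lemma4p6 a b _ _ _ i _ _ h (h-gap@(_ , _ , h∉S , _) , h%a≡i) h-min n _ b∣h+na n-min x = mk⇔ to from
  where
  h+ka∉S : ∀ k → k < n → ¬ InS a b (h + k * a)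
  h+ka∉S k k<n h+ka∈S with InS-+*-inv k h+ka∈S
  ... | inj₁ h∈S = h∉S h∈S
  ... | inj₂ (m , 0<m , m≤k , b∣h+ma) = n-min m 0<m (≤-<-trans m≤k k<n) b∣h+ma

  to : InIia a b i x → Σ ℕ (λ k → (k < n) × (x ≡ h + k * a))
  to x-gap@((_ , _ , x∉S , _) , x%a≡i)
    with %≡%∧≤⇒≡+* a (trans x%a≡i (sym h%a≡i)) (h-min x x-gap)
  ... | k , refl with n ≤? k
  ...   | yes n≤k = contradiction (∣+*⇒InS-+* b∣h+na n≤k) x∉S
  ...   | no n≰k = k , ≰⇒> n≰k , refl

  from : Σ ℕ (λ k → (k < n) × (x ≡ h + k * a)) → InIia a b i x
  from (k , k<n , refl) = IsolatedGap-+* k h-gap (h+ka∉S k k<n) , trans ([m+kn]%n≡m%n h k a) h%a≡i
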